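{- Let $\mathbb{K}\in\{\mathbb{R},\mathbb{C}\}$ and let $\mathcal{V}$ be a linear subspace of $M_n(\mathbb{K})$ that contains at least one nonsingular matrix. The following are equivalent: (i) there exists a nonsingular $A\in\mathcal{V}$ such that $A^{ -1}\mathcal{V}$ is a commuting subspace; (ii) for every nonsingular $A\in\mathcal{V}$, $A^{ -1}\mathcal{V}$ is a commuting subspace.
   Context: $A^{ -1}\mathcal{V}=\{A^{ -1}M: M\in\mathcal{V}\}$. A subspace of matrices is commuting if any two of its elements commute. -}

module Defs where

open import Level using (Level; _⊔_) renaming (suc to lsuc)
open import Data.Nat using (ℕ)
open import Data.Fin using (Fin; zero; suc)
open import Data.Product using (Σ; ∃; _×_; _,_)
open import Relation.Nullary using (¬_)
open import Algebra.Bundles using (CommutativeRing)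

record Field (c ℓ : Level) : Set (lsuc (c ⊔ ℓ)) where
  field
    commutativeRing : CommutativeRing c ℓ
  open CommutativeRing commutativeRing public
  field
    0≉1 : ¬ (0# ≈ 1#)
    inverse : ∀ x → ¬ (x ≈ 0#) → ∃ λ y → (x * y) ≈ 1#

module Matrices {c ℓ : Level} (K : Field c ℓ) where
  open Field K using (Carrier; _≈_; _+_; _*_; 0#; 1#)

  Mat : ℕ → Set c
  Mat n = Fin n → Fin n → Carrier

  ∑ : ∀ {n} → (Fin n → Carrier) → Carrier
  ∑ {ℕ.zero}  f = 0#
  ∑ {ℕ.suc n} f = f zero + ∑ (λ i → f (suc i))

  _≈ₘ_ : ∀ {n} → Mat n → Mat n → Set ℓ
  M ≈ₘ N = ∀ i j → M i j ≈ N i j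

  _*ₘ_ : ∀ {n} → Mat n → Mat n → Mat n
  (M *ₘ N) i j = ∑ (λ k → M i k * N k j)

  _+ₘ_ : ∀ {n} → Mat n → Mat n → Mat n
  (M +ₘ N) i j = M i j + N i j

  _·ₘ_ : ∀ {n} → Carrier → Mat n → Mat n
  (a ·ₘ M) i j = a * M i j

  0ₘ : ∀ {n} → Mat n
  0ₘ i j = 0#

  Iₘ : ∀ {n} → Mat n
  Iₘ zero    zero    = 1#
  Iₘ zero    (suc j) = 0#
  Iₘ (suc i) zero    = 0#
  Iₘ (suc i) (suc j) = Iₘ i j

  IsInverse : ∀ {n} → Mat n → Mat n → Set ℓ
  IsInverse A B = ((A *ₘ B) ≈ₘ Iₘ) × ((B *ₘ A) ≈ₘ Iₘ)

  Nonsingular : ∀ {n} → Mat n → Set (c ⊔ ℓ)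
  Nonsingular A = ∃ λ B → IsInverse A B

  record IsSubspace {n : ℕ} (V : Mat n → Set ℓ) : Set (c ⊔ ℓ) where
    field
      resp  : ∀ {M N} → M ≈ₘ N → V M → V N
      zero∈ : V 0ₘ
      +∈    : ∀ {M N} → V M → V N → V (M +ₘ N)
      ·∈    : ∀ a {M} → V M → V (a ·ₘ M)

  InvTimesCommuting : ∀ {n} (V : Mat n → Set ℓ) (A : Mat n) → Nonsingular A → Set (c ⊔ ℓ)
  InvTimesCommuting V A (B , _) =
    ∀ M N → V M → V N → ((B *ₘ M) *ₘ (B *ₘ N)) ≈ₘ ((B *ₘ N) *ₘ (B *ₘ M))

-- Fix a nonsingular A₀ ∈ V with A₀⁻¹V commuting, and let A ∈ V be any
-- nonsingular matrix. Then A⁻¹M = Q (A₀⁻¹M) with Q = A⁻¹A₀ = (A₀⁻¹A)⁻¹.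
-- Since A₀⁻¹A lies in the commuting set A₀⁻¹V, so does its inverse Q commute
-- with every A₀⁻¹M, whence (QX)(QY) = Q²XY = Q²YX = (QY)(QX).
module Submission where

open import Defs
open import Level using (Level; _⊔_)
open import Data.Nat using (ℕ; zero; suc)
open import Data.Fin using (Fin; zero; suc)
open import Data.Product using (Σ; ∃; _×_; _,_)
open import Function.Bundles using (_⇔_; mk⇔)
open import Algebra.Bundles using (Monoid)
open import Relation.Unary using (Pred)
open import Relation.Binary.PropositionalEquality as ≡ using (_≡_)
import Algebra.Properties.Monoid as MonoidProperties
import Algebra.Properties.Semiring.Sum as SemiringSum
import Relation.Binary.Reasoning.Setoid as SetoidReasoning

module Commuting {c ℓ : Level} (M : Monoid c ℓ) where
  open Monoid M
  open MonoidProperties M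
  open SetoidReasoning setoid

  Commute : Carrier → Carrier → Set ℓ
  Commute x y = x ∙ y ≈ y ∙ x

  IsInverse : Carrier → Carrier → Set ℓ
  IsInverse a b = (a ∙ b ≈ ε) × (b ∙ a ≈ ε)

  CommutingTranslate : ∀ {p} → Carrier → Pred Carrier p → Set (c ⊔ p ⊔ ℓ)
  CommutingTranslate b S = ∀ x y → S x → S y → Commute (b ∙ x) (b ∙ y)

  inverse-commute : ∀ {a b x} → IsInverse a b → Commute a x → Commute b x
  inverse-commute {a} {b} {x} (ab≈ε , ba≈ε) ax≈xa = begin
    b ∙ x              ≈⟨ insertʳ ab≈ε (b ∙ x) ⟩
    ((b ∙ x) ∙ a) ∙ b  ≈⟨ ∙-congʳ (assoc b x a) ⟩
    (b ∙ (x ∙ a)) ∙ b  ≈⟨ ∙-congʳ (∙-congˡ (sym ax≈xa)) ⟩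
    (b ∙ (a ∙ x)) ∙ b  ≈⟨ ∙-congʳ (cancelˡ ba≈ε x) ⟩
    x ∙ b              ∎

  ∙-commute-interchange : ∀ {q x} y → Commute q x → (q ∙ x) ∙ (q ∙ y) ≈ (q ∙ q) ∙ (x ∙ y)
  ∙-commute-interchange y qx≈xq = uv≈wx⇒yu∙vz≈yw∙xz (sym qx≈xq) _ y

  commute-∙ : ∀ {q x y} → Commute q x → Commute q y → Commute x y →
              Commute (q ∙ x) (q ∙ y)
  commute-∙ {q} {x} {y} qx qy xy = begin
    (q ∙ x) ∙ (q ∙ y)  ≈⟨ ∙-commute-interchange y qx ⟩
    (q ∙ q) ∙ (x ∙ y)  ≈⟨ ∙-congˡ xy ⟩
    (q ∙ q) ∙ (y ∙ x)  ≈⟨ ∙-commute-interchange x qy ⟨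
    (q ∙ y) ∙ (q ∙ x)  ∎

  commutingTranslate-transfer : ∀ {p} {S : Pred Carrier p} {a₀ b a a'} →
    IsInverse a₀ b → CommutingTranslate b S → S a → IsInverse a a' → CommutingTranslate a' S
  commutingTranslate-transfer {S = S} {a₀} {b} {a} {a'} (a₀b≈ε , ba₀≈ε) bS a∈S (aa'≈ε , a'a≈ε) x y x∈S y∈S = begin
    (a' ∙ x) ∙ (a' ∙ y)              ≈⟨ ∙-cong (factor x) (factor y) ⟩
    (q ∙ (b ∙ x)) ∙ (q ∙ (b ∙ y))    ≈⟨ commute-∙ (q-commute x∈S) (q-commute y∈S) (bS x y x∈S y∈S) ⟩
    (q ∙ (b ∙ y)) ∙ (q ∙ (b ∙ x))    ≈⟨ ∙-cong (factor y) (factor x) ⟨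
    (a' ∙ y) ∙ (a' ∙ x)              ∎
    where
    q : Carrier
    q = a' ∙ a₀

    factor : ∀ z → a' ∙ z ≈ q ∙ (b ∙ z)
    factor z = begin
      a' ∙ z               ≈⟨ ∙-congˡ (insertˡ a₀b≈ε z) ⟩
      a' ∙ (a₀ ∙ (b ∙ z))  ≈⟨ assoc a' a₀ (b ∙ z) ⟨
      q ∙ (b ∙ z)          ∎

    ba-inverse : IsInverse (b ∙ a) q
    ba-inverse = trans (cancelᶜ aa'≈ε b a₀) ba₀≈ε
               , trans (cancelᶜ a₀b≈ε a' a) a'a≈ε

    q-commute : ∀ {z} → S z → Commute q (b ∙ z)
    q-commute z∈S = inverse-commute ba-inverse (bS a _ a∈S z∈S)

module MatrixMonoid {c ℓ : Level} (K : Field c ℓ) where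
  open Field K hiding (zero)
  open Matrices K
  open SemiringSum semiring using (sum; sum-cong-≋; sum-replicate-zero; ∑-comm; *-distribˡ-sum; *-distribʳ-sum)
  open SetoidReasoning setoid

  ∑≡sum : ∀ {n} (f : Fin n → Carrier) → ∑ f ≡ sum f
  ∑≡sum {zero}  f = ≡.refl
  ∑≡sum {suc n} f = ≡.cong (f zero +_) (∑≡sum (λ i → f (suc i)))

  ∑-cong : ∀ {n} {f g : Fin n → Carrier} → (∀ i → f i ≈ g i) → ∑ f ≈ ∑ g
  ∑-cong {f = f} {g} f≈g = begin
    ∑ f    ≡⟨ ∑≡sum f ⟩
    sum f  ≈⟨ sum-cong-≋ f≈g ⟩
    sum g  ≡⟨ ∑≡sum g ⟨
    ∑ g    ∎

  ∑-zero : ∀ {n} {f : Fin n → Carrier} → (∀ i → f i ≈ 0#) → ∑ f ≈ 0#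
  ∑-zero {n} f≈0 = trans (∑-cong f≈0) (trans (reflexive (∑≡sum {n} (λ _ → 0#))) (sum-replicate-zero n))

  *ₘ-entry : ∀ {n} (M N : Mat n) i j → (M *ₘ N) i j ≈ sum (λ k → M i k * N k j)
  *ₘ-entry M N i j = reflexive (∑≡sum (λ k → M i k * N k j))

  *ₘ-assoc : ∀ {n} (M N P : Mat n) → ((M *ₘ N) *ₘ P) ≈ₘ (M *ₘ (N *ₘ P))
  *ₘ-assoc M N P i j = begin
    ((M *ₘ N) *ₘ P) i j
      ≈⟨ trans (*ₘ-entry (M *ₘ N) P i j) (sum-cong-≋ (λ k → *-congʳ (*ₘ-entry M N i k))) ⟩
    sum (λ k → sum (λ l → M i l * N l k) * P k j)
      ≈⟨ sum-cong-≋ (λ k → *-distribʳ-sum (P k j) (λ l → M i l * N l k)) ⟩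
    sum (λ k → sum (λ l → M i l * N l k * P k j))
      ≈⟨ ∑-comm (λ k l → M i l * N l k * P k j) ⟩
    sum (λ l → sum (λ k → M i l * N l k * P k j))
      ≈⟨ sum-cong-≋ (λ l → sum-cong-≋ (λ k → *-assoc (M i l) (N l k) (P k j))) ⟩
    sum (λ l → sum (λ k → M i l * (N l k * P k j)))
      ≈⟨ sum-cong-≋ (λ l → *-distribˡ-sum (M i l) (λ k → N l k * P k j)) ⟨
    sum (λ l → M i l * sum (λ k → N l k * P k j))
      ≈⟨ trans (*ₘ-entry M (N *ₘ P) i j) (sum-cong-≋ (λ l → *-congˡ (*ₘ-entry N P l j))) ⟨
    (M *ₘ (N *ₘ P)) i j ∎

  ∑-Iₘ-selectˡ : ∀ {n} i (f : Fin n → Carrier) → ∑ (λ k → Iₘ i k * f k) ≈ f i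
  ∑-Iₘ-selectˡ zero    f = trans (+-cong (*-identityˡ _) (∑-zero (λ k → zeroˡ (f (suc k))))) (+-identityʳ _)
  ∑-Iₘ-selectˡ (suc i) f = trans (+-cong (zeroˡ _) (∑-Iₘ-selectˡ i (λ k → f (suc k)))) (+-identityˡ _)

  ∑-Iₘ-selectʳ : ∀ {n} j (f : Fin n → Carrier) → ∑ (λ k → f k * Iₘ k j) ≈ f j
  ∑-Iₘ-selectʳ zero    f = trans (+-cong (*-identityʳ _) (∑-zero (λ k → zeroʳ (f (suc k))))) (+-identityʳ _)
  ∑-Iₘ-selectʳ (suc j) f = trans (+-cong (zeroʳ _) (∑-Iₘ-selectʳ j (λ k → f (suc k)))) (+-identityˡ _)

  Mat-monoid : ℕ → Monoid c ℓ
  Mat-monoid n = record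
    { Carrier  = Mat n
    ; _≈_      = _≈ₘ_
    ; _∙_      = _*ₘ_
    ; ε        = Iₘ
    ; isMonoid = record
      { isSemigroup = record
        { isMagma = record
          { isEquivalence = record
            { refl  = λ i j → refl
            ; sym   = λ M≈N i j → sym (M≈N i j)
            ; trans = λ M≈N N≈P i j → trans (M≈N i j) (N≈P i j)
            }
          ; ∙-cong = λ M≈M' N≈N' i j → ∑-cong (λ k → *-cong (M≈M' i k) (N≈N' k j))
          }
        ; assoc = *ₘ-assoc
        }
      ; identity = (λ M i j → ∑-Iₘ-selectˡ i (λ k → M k j))
                 , (λ M i j → ∑-Iₘ-selectʳ j (λ k → M i k))
      }
    }

theorem2p6 : ∀ {c ℓ : Level} (K : Field c ℓ) (n : ℕ)
    (V : Matrices.Mat K n → Set ℓ)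
    → Matrices.IsSubspace K V
    → (∃ λ A → V A × Matrices.Nonsingular K A)
    → (∃ λ A → V A × Σ (Matrices.Nonsingular K A) λ nsA → Matrices.InvTimesCommuting K V A nsA)
    ⇔ (∀ A → V A → (nsA : Matrices.Nonsingular K A) → Matrices.InvTimesCommuting K V A nsA)
theorem2p6 {c} {ℓ} K n V _ (A₀ , A₀∈V , A₀-nonsingular) = mk⇔ all-commuting some-commuting
  where
  open Matrices K using (Nonsingular; InvTimesCommuting)
  open Commuting (MatrixMonoid.Mat-monoid K n) using (commutingTranslate-transfer)

  SomeCommuting AllCommuting : Set (c ⊔ ℓ)
  SomeCommuting = ∃ λ A → V A × Σ (Nonsingular A) (InvTimesCommuting V A)
  AllCommuting  = ∀ A → V A → (nsA : Nonsingular A) → InvTimesCommuting V A nsA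

  all-commuting : SomeCommuting → AllCommuting
  all-commuting (A₁ , _ , (B , A₁B) , A₁⁻¹V) A A∈V (A' , AA') =
    commutingTranslate-transfer A₁B A₁⁻¹V A∈V AA'

  some-commuting : AllCommuting → SomeCommuting
  some-commuting all = A₀ , A₀∈V , A₀-nonsingular , all A₀ A₀∈V A₀-nonsingular
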